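{- Let $G$ be a finite connected graph, let $q,v\in V(G)$ be distinct, and let $D$ be an effective $q$-reduced divisor with $D(v)=0$. Run one iteration of Dhar's burning algorithm on $D$ starting from $v$. If the vertex $q$ burns, then $r(D)=0$.
   Context: Graphs may have multiple edges but no loops. A divisor is an integer combination $D=\sum_wD(w)(w)$ of vertices; effective means all $D(w)\ge0$. Firing a set $U\subset V(G)$ moves one chip along each edge from $U$ to its complement; it is a legal firing move if the result has no new negative entries. $D$ is $q$-reduced if $D(w)\ge0$ for all $w\ne q$ and no nonempty $U\subset V(G)\setminus\{q\}$ is a legal firing move. One iteration of Dhar's burning algorithm on $D$ from a vertex $s$: start a fire at $s$; repeatedly, every edge incident to a burning vertex burns, and any vertex $w$ incident to more than $D(w)$ burning edges burns; continue until no change. Divisors are equivalent if their difference is in the integer column space of the Laplacian; the rank $r(D)$ is $-1$ if $D$ is not equivalent to an effective divisor, else the largest $r\ge0$ such that $D-E$ is equivalent to an effective divisor for all effective $E$ of degree $r$. -}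

module Defs where

open import Data.Nat as ℕ using (ℕ; zero; suc)
open import Data.Integer as ℤ using (ℤ; +_; _-_; _<_; _≤_; 0ℤ)
open import Data.Fin using (Fin)
open import Data.Bool using (Bool; true; false; if_then_else_; not; _∨_)
open import Data.List using (List; map; allFin)
open import Data.Product using (Σ; ∃; _×_)
open import Relation.Binary.PropositionalEquality using (_≡_)
open import Relation.Nullary using (¬_)

data Reachable {n : ℕ} (A : Fin n → Fin n → ℕ) : Fin n → Fin n → Set where
  here : ∀ {u} → Reachable A u u
  step : ∀ {u w v} → 0 ℕ.< A u w → Reachable A w v → Reachable A u v

record Graph (n : ℕ) : Set where
  field
    mult      : Fin n → Fin n → ℕ
    symmetric : ∀ u w → mult u w ≡ mult w u
    loopless  : ∀ u → mult u u ≡ 0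
open Graph public

Connected : ∀ {n} → Graph n → Set
Connected {n} G = ∀ (u w : Fin n) → Reachable (mult G) u w

Σᵥ : ∀ {n} → (Fin n → ℤ) → ℤ
Σᵥ {n} f = Data.List.foldr ℤ._+_ 0ℤ (map f (allFin n))

Divisor : ℕ → Set
Divisor n = Fin n → ℤ

Effective : ∀ {n} → Divisor n → Set
Effective D = ∀ w → 0ℤ ≤ D w

deg : ∀ {n} → Divisor n → ℤ
deg D = Σᵥ D

valence : ∀ {n} → Graph n → Fin n → ℤ
valence G w = Σᵥ (λ u → + mult G w u)

laplacian : ∀ {n} → Graph n → (Fin n → ℤ) → Fin n → ℤ
laplacian G x w = valence G w ℤ.* x w - Σᵥ (λ u → + mult G w u ℤ.* x u)

Equiv : ∀ {n} → Graph n → Divisor n → Divisor n → Set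
Equiv {n} G D D' = Σ (Fin n → ℤ) λ x → ∀ w → D w - D' w ≡ laplacian G x w

VSet : ℕ → Set
VSet n = Fin n → Bool

edgesTo : ∀ {n} → Graph n → VSet n → Fin n → ℤ
edgesTo G U w = Σᵥ (λ u → if U u then + mult G w u else 0ℤ)

fire : ∀ {n} → Graph n → VSet n → Divisor n → Divisor n
fire G U D w =
  if U w then D w - edgesTo G (λ u → not (U u)) w
         else D w ℤ.+ edgesTo G U w

LegalFiring : ∀ {n} → Graph n → VSet n → Divisor n → Set
LegalFiring G U D = ∀ w → fire G U D w < 0ℤ → D w < 0ℤ

Nonempty : ∀ {n} → VSet n → Set
Nonempty U = ∃ λ w → U w ≡ true

QReduced : ∀ {n} → Graph n → Fin n → Divisor n → Set
QReduced G q D =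
  (∀ w → ¬ (w ≡ q) → 0ℤ ≤ D w) ×
  (∀ (U : VSet _) → Nonempty U → U q ≡ false → ¬ LegalFiring G U D)

EquivEffective : ∀ {n} → Graph n → Divisor n → Set
EquivEffective G D = Σ (Divisor _) λ D' → Effective D' × Equiv G D D'

RankAtLeast : ∀ {n} → Graph n → Divisor n → ℕ → Set
RankAtLeast G D r =
  ∀ (E : Divisor _) → Effective E → deg E ≡ + r →
    EquivEffective G (λ w → D w - E w)

RankZero : ∀ {n} → Graph n → Divisor n → Set
RankZero G D = RankAtLeast G D 0 × (∀ r → 1 ℕ.≤ r → ¬ RankAtLeast G D r)

-- Dhar's burning algorithm from s. burnStep adds every vertex w incident
-- to more than D(w) burning edges (edges with a burning endpoint; for a
-- non-burning w these are the edges from w to burning vertices).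
burnStep : ∀ {n} → Graph n → Divisor n → VSet n → VSet n
burnStep G D B w with B w
... | true  = true
... | false with ℤ._<?_ (D w) (edgesTo G B w)
...   | Relation.Nullary.yes _ = true
...   | Relation.Nullary.no  _ = false

burnIter : ∀ {n} → Graph n → Divisor n → Fin n → ℕ → VSet n
burnIter G D s zero w with Data.Fin._≟_ w s
... | Relation.Nullary.yes _ = true
... | Relation.Nullary.no  _ = false
burnIter G D s (suc k) = burnStep G D (burnIter G D s k)

-- w burns (at some stage, i.e. in the final stable burnt set)
Burns : ∀ {n} → Graph n → Divisor n → Fin n → Fin n → Set
Burns G D s w = ∃ λ k → burnIter G D s k w ≡ true

-- Suppose D - r(v) ~ D' with D' effective and r ≥ 1, say D - r(v) - D' = Δx. On the set U
-- where x attains its maximum, (Δx)(w) is at least the number of edges leaving U, so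
-- D(w) ≥ that number for w ∈ U: firing U from D is legal, and U cannot be set on fire from
-- outside. As q burns from v, U ⊆ V \ {q} would contradict q-reducedness, so U contains v,
-- q ∉ U, and then 0 = D(v) ≥ r + (Δx)(v) ≥ r is absurd. Rank ≥ 0 is immediate as D ≥ 0.
module Submission where

open import Defs
open import Data.Nat using (ℕ)
open import Data.Integer using (0ℤ)
open import Data.Fin using (Fin)
open import Relation.Binary.PropositionalEquality using (_≡_)
open import Relation.Nullary using (¬_)

import Data.Nat as ℕ
open import Data.Integer as ℤ using (ℤ; +_; _-_; _+_; _*_; -_; 1ℤ; _≤_; _<_; +≤+; +<+)
open import Data.Integer.Properties
open import Data.Integer.Solver using (module +-*-Solver)
open import Data.Fin as Fin using (zero; suc)
open import Data.Bool using (true; false; if_then_else_; not)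
open import Data.List using (foldr; allFin)
open import Data.List.Properties using (map-tabulate)
open import Data.List.Membership.Propositional.Properties using (∈-allFin)
import Data.List.Relation.Unary.All as All
open import Data.List.Extrema ≤-totalOrder using (argmax; f[xs]≤f[argmax])
open import Data.Product using (_,_)
open import Data.Empty using (⊥-elim)
open import Relation.Binary.PropositionalEquality
  using (refl; sym; trans; cong; cong₂; subst; subst₂; module ≡-Reasoning)
open import Relation.Nullary using (yes; no; does)
open import Relation.Nullary.Decidable using (dec-true)

open +-*-Solver

private
  variable
    n : ℕ

Σᵥ-suc : (f : Fin (ℕ.suc n) → ℤ) → Σᵥ f ≡ f zero + Σᵥ (λ i → f (suc i))
Σᵥ-suc {n} f = cong (λ xs → f zero + foldr _+_ 0ℤ xs)
  (trans (map-tabulate suc f) (sym (map-tabulate (λ i → i) (λ i → f (suc i)))))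

Σᵥ-cong : {f g : Fin n → ℤ} → (∀ i → f i ≡ g i) → Σᵥ f ≡ Σᵥ g
Σᵥ-cong {ℕ.zero}  f≡g = refl
Σᵥ-cong {ℕ.suc n} {f} {g} f≡g = begin
  Σᵥ f                            ≡⟨ Σᵥ-suc f ⟩
  f zero + Σᵥ (λ i → f (suc i))   ≡⟨ cong₂ _+_ (f≡g zero) (Σᵥ-cong (λ i → f≡g (suc i))) ⟩
  g zero + Σᵥ (λ i → g (suc i))   ≡⟨ sym (Σᵥ-suc g) ⟩
  Σᵥ g                            ∎
  where open ≡-Reasoning

Σᵥ-mono-≤ : {f g : Fin n → ℤ} → (∀ i → f i ≤ g i) → Σᵥ f ≤ Σᵥ g
Σᵥ-mono-≤ {ℕ.zero}  f≤g = ≤-refl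
Σᵥ-mono-≤ {ℕ.suc n} {f} {g} f≤g = subst₂ _≤_ (sym (Σᵥ-suc f)) (sym (Σᵥ-suc g))
  (+-mono-≤ (f≤g zero) (Σᵥ-mono-≤ (λ i → f≤g (suc i))))

Σᵥ-zero : Σᵥ {n} (λ _ → 0ℤ) ≡ 0ℤ
Σᵥ-zero {ℕ.zero}  = refl
Σᵥ-zero {ℕ.suc n} = trans (Σᵥ-suc {n} (λ _ → 0ℤ)) (trans (+-identityˡ _) (Σᵥ-zero {n}))

Σᵥ-nonneg : {f : Fin n → ℤ} → (∀ i → 0ℤ ≤ f i) → 0ℤ ≤ Σᵥ f
Σᵥ-nonneg {n} {f} 0≤f = subst (_≤ Σᵥ f) (Σᵥ-zero {n}) (Σᵥ-mono-≤ 0≤f)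

f≤Σᵥf : {f : Fin n → ℤ} → (∀ i → 0ℤ ≤ f i) → ∀ i → f i ≤ Σᵥ f
f≤Σᵥf {ℕ.suc n} {f} 0≤f i = subst (f i ≤_) (sym (Σᵥ-suc f)) (term i)
  where
  term : ∀ i → f i ≤ f zero + Σᵥ (λ j → f (suc j))
  term zero    = i≤i+j (f zero) _ {{ℤ.nonNegative (Σᵥ-nonneg (λ j → 0≤f (suc j)))}}
  term (suc i) = i≤j⇒i≤k+j (f zero) {{ℤ.nonNegative (0≤f zero)}}
                   (f≤Σᵥf (λ j → 0≤f (suc j)) i)

point : Fin n → ℤ → Divisor n
point v c u = if does (u Fin.≟ v) then c else 0ℤ

deg-point : (v : Fin n) (c : ℤ) → deg (point v c) ≡ c
deg-point {ℕ.suc n} zero c = begin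
  Σᵥ (point {ℕ.suc n} zero c)  ≡⟨ Σᵥ-suc {n} (point zero c) ⟩
  c + Σᵥ {n} (λ _ → 0ℤ)   ≡⟨ cong (_+_ c) (Σᵥ-zero {n}) ⟩
  c + 0ℤ                  ≡⟨ +-identityʳ c ⟩
  c                       ∎
  where open ≡-Reasoning
deg-point {ℕ.suc n} (suc v) c =
  trans (Σᵥ-suc {n} (point (suc v) c)) (trans (+-identityˡ _) (deg-point v c))

Σᵥ-sub : (f g : Fin n → ℤ) → Σᵥ f - Σᵥ g ≡ Σᵥ (λ i → f i - g i)
Σᵥ-sub {ℕ.zero}  f g = refl
Σᵥ-sub {ℕ.suc n} f g = begin
  Σᵥ f - Σᵥ g
    ≡⟨ cong₂ _-_ (Σᵥ-suc f) (Σᵥ-suc g) ⟩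
  (f zero + Σᵥ (λ i → f (suc i))) - (g zero + Σᵥ (λ i → g (suc i)))
    ≡⟨ interchange (f zero) (g zero) _ _ ⟩
  (f zero - g zero) + (Σᵥ (λ i → f (suc i)) - Σᵥ (λ i → g (suc i)))
    ≡⟨ cong (_+_ (f zero - g zero)) (Σᵥ-sub (λ i → f (suc i)) (λ i → g (suc i))) ⟩
  (f zero - g zero) + Σᵥ (λ i → f (suc i) - g (suc i))
    ≡⟨ sym (Σᵥ-suc (λ i → f i - g i)) ⟩
  Σᵥ (λ i → f i - g i) ∎
  where
  open ≡-Reasoning
  interchange : ∀ a b c d → (a + c) - (b + d) ≡ (a - b) + (c - d)
  interchange = solve 4 (λ a b c d → (a :+ c) :- (b :+ d) := (a :- b) :+ (c :- d)) refl

Σᵥ-distribʳ-* : (f : Fin n → ℤ) (c : ℤ) → Σᵥ f * c ≡ Σᵥ (λ i → f i * c)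
Σᵥ-distribʳ-* {ℕ.zero}  f c = refl
Σᵥ-distribʳ-* {ℕ.suc n} f c = begin
  Σᵥ f * c                                      ≡⟨ cong (_* c) (Σᵥ-suc f) ⟩
  (f zero + Σᵥ (λ i → f (suc i))) * c            ≡⟨ *-distribʳ-+ c (f zero) _ ⟩
  f zero * c + Σᵥ (λ i → f (suc i)) * c          ≡⟨ cong (_+_ (f zero * c)) (Σᵥ-distribʳ-* (λ i → f (suc i)) c) ⟩
  f zero * c + Σᵥ (λ i → f (suc i) * c)          ≡⟨ sym (Σᵥ-suc (λ i → f i * c)) ⟩
  Σᵥ (λ i → f i * c)                             ∎
  where open ≡-Reasoning

edgesTo-nonneg : (G : Graph n) (U : VSet n) (w : Fin n) → 0ℤ ≤ edgesTo G U w
edgesTo-nonneg G U w = Σᵥ-nonneg edge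
  where
  edge : ∀ u → 0ℤ ≤ (if U u then + mult G w u else 0ℤ)
  edge u with U u
  ... | true  = +≤+ ℕ.z≤n
  ... | false = ≤-refl

edgesTo-mono : (G : Graph n) {U W : VSet n} → (∀ u → U u ≡ true → W u ≡ true) →
               ∀ w → edgesTo G U w ≤ edgesTo G W w
edgesTo-mono G {U} {W} U⊆W w = Σᵥ-mono-≤ edge
  where
  edge : ∀ u → (if U u then + mult G w u else 0ℤ) ≤ (if W u then + mult G w u else 0ℤ)
  edge u with U u in Uu | W u in Wu
  ... | true  | true  = ≤-refl
  ... | true  | false with () ← trans (sym (U⊆W u Uu)) Wu
  ... | false | true  = +≤+ ℕ.z≤n
  ... | false | false = ≤-refl

laplacian≡Σ : (G : Graph n) (x : Fin n → ℤ) (w : Fin n) →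
              laplacian G x w ≡ Σᵥ (λ u → + mult G w u * (x w - x u))
laplacian≡Σ G x w = begin
  valence G w * x w - Σᵥ (λ u → m u * x u)      ≡⟨ cong (_- Σᵥ (λ u → m u * x u)) (Σᵥ-distribʳ-* m (x w)) ⟩
  Σᵥ (λ u → m u * x w) - Σᵥ (λ u → m u * x u)   ≡⟨ Σᵥ-sub (λ u → m u * x w) (λ u → m u * x u) ⟩
  Σᵥ (λ u → m u * x w - m u * x u)              ≡⟨ Σᵥ-cong (λ u → factor (m u) (x w) (x u)) ⟩
  Σᵥ (λ u → m u * (x w - x u))                  ∎
  where
  open ≡-Reasoning
  m : Fin _ → ℤ
  m u = + mult G w u
  factor : ∀ a b c → a * b - a * c ≡ a * (b - c)
  factor = solve 3 (λ a b c → a :* b :- a :* c := a :* (b :- c)) refl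

laplacian-const : (G : Graph n) (c : ℤ) (w : Fin n) → laplacian G (λ _ → c) w ≡ 0ℤ
laplacian-const {n} G c w = begin
  laplacian G (λ _ → c) w              ≡⟨ laplacian≡Σ G (λ _ → c) w ⟩
  Σᵥ (λ u → + mult G w u * (c - c))    ≡⟨ Σᵥ-cong (λ u → trans (cong (_*_ (+ mult G w u)) (+-inverseʳ c)) (*-zeroʳ (+ mult G w u))) ⟩
  Σᵥ {n} (λ _ → 0ℤ)                    ≡⟨ Σᵥ-zero {n} ⟩
  0ℤ                                   ∎
  where open ≡-Reasoning

Equiv-refl : (G : Graph n) (D : Divisor n) → Equiv G D D
Equiv-refl G D = (λ _ → 0ℤ) , λ w → trans (+-inverseʳ (D w)) (sym (laplacian-const G 0ℤ w))

levelSet : (Fin n → ℤ) → ℤ → VSet n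
levelSet x M u = does (x u ℤ.≟ M)

i<j⇒1≤j-i : {i j : ℤ} → i < j → 1ℤ ≤ j - i
i<j⇒1≤j-i {i} {j} i<j = subst (_≤ j - i) (cancel i) (+-monoˡ-≤ (- i) (i<j⇒suc[i]≤j i<j))
  where
  cancel : ∀ a → 1ℤ + a - a ≡ 1ℤ
  cancel = solve 1 (λ a → con 1ℤ :+ a :- a := con 1ℤ) refl

-- At a maximum w of x, every edge to a vertex outside the top level contributes x w - x u ≥ 1.
edgesLeavingMax≤laplacian : (G : Graph n) (x : Fin n → ℤ) {M : ℤ} → (∀ u → x u ≤ M) →
  ∀ w → x w ≡ M → edgesTo G (λ u → not (levelSet x M u)) w ≤ laplacian G x w
edgesLeavingMax≤laplacian G x x≤M w refl =
  subst (edgesTo G (λ u → not (levelSet x (x w) u)) w ≤_) (sym (laplacian≡Σ G x w)) (Σᵥ-mono-≤ edge)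
  where
  edge : ∀ u → (if not (levelSet x (x w) u) then + mult G w u else 0ℤ) ≤ + mult G w u * (x w - x u)
  edge u with x u ℤ.≟ x w
  ... | yes _    = subst (_≤ + mult G w u * (x w - x u)) (*-zeroʳ (+ mult G w u))
                     (*-monoˡ-≤-nonNeg (+ mult G w u) (i≤j⇒0≤j-i (x≤M u)))
  ... | no xu≢xw = subst (_≤ + mult G w u * (x w - x u)) (*-identityʳ (+ mult G w u))
                     (*-monoˡ-≤-nonNeg (+ mult G w u) (i<j⇒1≤j-i (≤∧≢⇒< (x≤M u) xu≢xw)))

Fireable : Graph n → Divisor n → VSet n → Set
Fireable G D U = ∀ w → U w ≡ true → edgesTo G (λ u → not (U u)) w ≤ D w

fireable⇒legal : (G : Graph n) {D : Divisor n} {U : VSet n} → Fireable G D U → LegalFiring G U D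
fireable⇒legal G {D} {U} fireable w fire<0 with U w in Uw
... | true  = ⊥-elim (<⇒≱ fire<0 (i≤j⇒0≤j-i (fireable w Uw)))
... | false = ≤-<-trans (i≤i+j (D w) (edgesTo G U w) {{ℤ.nonNegative (edgesTo-nonneg G U w)}}) fire<0

fireable⇒unburnt : (G : Graph n) {D : Divisor n} {U : VSet n} {s : Fin n} →
  Fireable G D U → U s ≡ false → ∀ k w → U w ≡ true → burnIter G D s k w ≡ false
fireable⇒unburnt G {D} {U} {s} fireable Us ℕ.zero w Uw with w Fin.≟ s
... | yes refl with () ← trans (sym Uw) Us
... | no _ = refl
fireable⇒unburnt G {D} {U} {s} fireable Us (ℕ.suc k) w Uw
  rewrite fireable⇒unburnt G fireable Us k w Uw
  with D w ℤ.<? edgesTo G (burnIter G D s k) w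
... | no _ = refl
... | yes D<burning = ⊥-elim (<⇒≱ D<burning (≤-trans (edgesTo-mono G burnt⇒outside w) (fireable w Uw)))
  where
  burnt⇒outside : ∀ u → burnIter G D s k u ≡ true → not (U u) ≡ true
  burnt⇒outside u burnt with U u in Uu
  ... | false = refl
  ... | true with () ← trans (sym burnt) (fireable⇒unburnt G fireable Us k u Uu)

fireable-contains-source : (G : Graph n) {q s : Fin n} {D : Divisor n} {U : VSet n} →
  QReduced G q D → Burns G D s q → Fireable G D U → Nonempty U → U s ≡ true
fireable-contains-source G {q} {s} {U = U} (_ , reduced) (k , q-burns) fireable nonempty
  with U s in Us
... | true = refl
... | false with U q in Uq
...   | false = ⊥-elim (reduced U nonempty Uq (fireable⇒legal G fireable))
...   | true with () ← trans (sym q-burns) (fireable⇒unburnt G fireable Us k q Uq)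

levelSet⇒≡ : (x : Fin n → ℤ) {M : ℤ} {u : Fin n} → levelSet x M u ≡ true → x u ≡ M
levelSet⇒≡ x {M} {u} xu∈ with x u ℤ.≟ M
... | yes xu≡M = xu≡M

levelSet-fireable : (G : Graph n) {D : Divisor n} (x : Fin n → ℤ) {M : ℤ} →
  (∀ w → laplacian G x w ≤ D w) → (∀ u → x u ≤ M) → Fireable G D (levelSet x M)
levelSet-fireable G x Δx≤D x≤M w w∈ =
  ≤-trans (edgesLeavingMax≤laplacian G x x≤M w (levelSet⇒≡ x w∈)) (Δx≤D w)

point-effective : (v : Fin n) {c : ℤ} → 0ℤ ≤ c → Effective (point v c)
point-effective v 0≤c w with w Fin.≟ v
... | yes _ = 0≤c
... | no _  = ≤-refl

effective⇒RankAtLeast0 : (G : Graph n) {D : Divisor n} → Effective D → RankAtLeast G D 0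
effective⇒RankAtLeast0 G {D} effD E effE degE =
  (λ w → D w - E w) , (λ w → i≤j⇒0≤j-i (≤-trans (E≤0 w) (effD w))) , Equiv-refl G (λ w → D w - E w)
  where
  E≤0 : ∀ w → E w ≤ 0ℤ
  E≤0 w = subst (E w ≤_) degE (f≤Σᵥf effE w)

laplacian+E≤D : (G : Graph n) {D E D' : Divisor n} {x : Fin n → ℤ} →
  Effective D' → (∀ w → (D w - E w) - D' w ≡ laplacian G x w) →
  ∀ w → E w + laplacian G x w ≤ D w
laplacian+E≤D G {D} {E} {D'} {x} effD' D-E-D'≡Δx w =
  subst (E w + laplacian G x w ≤_) D'+E+Δx≡D (i≤j+i _ (D' w) {{ℤ.nonNegative (effD' w)}})
  where
  regroup : ∀ d e d' → d' + (e + ((d - e) - d')) ≡ d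
  regroup = solve 3 (λ d e d' → d' :+ (e :+ ((d :- e) :- d')) := d) refl
  D'+E+Δx≡D : D' w + (E w + laplacian G x w) ≡ D w
  D'+E+Δx≡D = trans (cong (λ Δ → D' w + (E w + Δ)) (sym (D-E-D'≡Δx w))) (regroup (D w) (E w) (D' w))

¬EquivEffective-sub-point : (G : Graph n) {q v : Fin n} {D : Divisor n} {r : ℕ} →
  QReduced G q D → Burns G D v q → D v ≡ 0ℤ → 1 ℕ.≤ r →
  ¬ EquivEffective G (λ w → D w - point v (+ r) w)
¬EquivEffective-sub-point {n} G {q} {v} {D} {r} reduced q-burns Dv≡0 1≤r (D' , effD' , x , eq) =
  <⇒≱ (+<+ 1≤r) r≤0
  where
  E : Divisor n
  E = point v (+ r)
  top : Fin n
  top = argmax x v (allFin n)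
  x≤top : ∀ u → x u ≤ x top
  x≤top u = All.lookup (f[xs]≤f[argmax] v (allFin n)) (∈-allFin u)
  bound : ∀ w → E w + laplacian G x w ≤ D w
  bound = laplacian+E≤D G effD' eq
  Δx≤D : ∀ w → laplacian G x w ≤ D w
  Δx≤D w = ≤-trans (i≤j+i _ (E w) {{ℤ.nonNegative (point-effective v (+≤+ ℕ.z≤n) w)}}) (bound w)
  v∈top : levelSet x (x top) v ≡ true
  v∈top = fireable-contains-source G reduced q-burns (levelSet-fireable G x Δx≤D x≤top)
            (top , dec-true (x top ℤ.≟ x top) refl)
  0≤Δxv : 0ℤ ≤ laplacian G x v
  0≤Δxv = ≤-trans (edgesTo-nonneg G _ v) (edgesLeavingMax≤laplacian G x x≤top v (levelSet⇒≡ x v∈top))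
  Ev≡r : E v ≡ + r
  Ev≡r = cong (if_then + r else 0ℤ) (dec-true (v Fin.≟ v) refl)
  r≤0 : + r ≤ 0ℤ
  r≤0 = ≤-trans (i≤i+j (+ r) _ {{ℤ.nonNegative 0≤Δxv}})
          (subst₂ (λ Ev Dv → Ev + laplacian G x v ≤ Dv) Ev≡r Dv≡0 (bound v))

lemma2p2 : ∀ {n : ℕ} (G : Graph n) → Connected G →
    (q v : Fin n) → ¬ (q ≡ v) →
    (D : Divisor n) → Effective D → QReduced G q D → D v ≡ 0ℤ →
    Burns G D v q →
    RankZero G D
lemma2p2 G _ q v _ D effD reduced Dv≡0 q-burns =
  effective⇒RankAtLeast0 G effD ,
  λ r 1≤r rank≥r → ¬EquivEffective-sub-point G reduced q-burns Dv≡0 1≤r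
    (rank≥r (point v (+ r)) (point-effective v (+≤+ ℕ.z≤n)) (deg-point v (+ r)))
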